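{- Let $h_1,\dots,h_k$ be positive integers. If an $\mathrm{LS}(h_1\dots h_k)$ exists, then an $\mathrm{ROS}(h_1\dots h_k)$ exists.
   Context: For positive integers $h_1,\dots,h_k$ with $n=\sum_i h_i$, an $\mathrm{LS}(h_1\dots h_k)$ is a latin square of order $n$ containing $k$ pairwise disjoint subsquares of orders $h_1,\dots,h_k$ (a subsquare is a square subarray which is itself a latin square; disjoint means sharing no rows, columns or symbols). Given a sequence $P=(p_1,\dots,p_k)$ of positive integers, an $\mathrm{ROS}(P)$ is an assignment of a non-negative rational number $O(i,j,\ell)$ to every multiset $\{i,j,\ell\}$ of elements of $[k]$ (invariant under permuting $i,j,\ell$) such that $\sum_{\ell\in[k]}O(i,j,\ell)=p_ip_j$ for all $i,j\in[k]$, and $O(i,i,i)=p_i^2$ and $O(i,i,j)=0$ for all $i\neq j$. -}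

module Defs where

open import Data.Nat using (ℕ; zero; suc; _*_; _+_)
open import Data.Fin using (Fin; zero; suc)
open import Data.Integer using (+_)
open import Data.Rational using (ℚ; _/_; 0ℚ) renaming (_+_ to _+ℚ_; _≤_ to _≤ℚ_)
open import Data.Product using (Σ; ∃; _×_)
open import Relation.Binary.PropositionalEquality using (_≡_; _≢_)
open import Relation.Nullary using (¬_)

sumℕ : ∀ {k} → (Fin k → ℕ) → ℕ
sumℕ {zero}  f = 0
sumℕ {suc k} f = f zero + sumℕ (λ i → f (suc i))

sumℚ : ∀ {k} → (Fin k → ℚ) → ℚ
sumℚ {zero}  f = 0ℚ
sumℚ {suc k} f = f zero +ℚ sumℚ (λ i → f (suc i))

ℕ→ℚ : ℕ → ℚ
ℕ→ℚ m = (+ m) / 1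

Injective : ∀ {A B : Set} → (A → B) → Set
Injective f = ∀ x y → f x ≡ f y → x ≡ y

record IsLatin {n : ℕ} (L : Fin n → Fin n → Fin n) : Set where
  field
    rowInj  : ∀ r → Injective (λ c → L r c)
    rowSurj : ∀ r s → ∃ λ c → L r c ≡ s
    colInj  : ∀ c → Injective (λ r → L r c)
    colSurj : ∀ c s → ∃ λ r → L r c ≡ s

-- A subsquare of order h of L: h distinct rows, h distinct columns and
-- h distinct symbols, such that the h×h subarray on those rows/columns is
-- a latin square on those symbols.
record Subsquare {n : ℕ} (L : Fin n → Fin n → Fin n) (h : ℕ) : Set where
  field
    rows : Fin h → Fin n
    cols : Fin h → Fin n
    syms : Fin h → Fin n
    rowsInj : Injective rows
    colsInj : Injective cols
    symsInj : Injective syms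
    sub     : Fin h → Fin h → Fin h
    subEq   : ∀ i j → L (rows i) (cols j) ≡ syms (sub i j)
    subLatin : IsLatin sub
open Subsquare public

Disjoint : ∀ {n h h'} {L : Fin n → Fin n → Fin n} → Subsquare L h → Subsquare L h' → Set
Disjoint S T =
  (∀ i j → rows S i ≢ rows T j) ×
  (∀ i j → cols S i ≢ cols T j) ×
  (∀ i j → syms S i ≢ syms T j)

LS : ∀ {k} → (Fin k → ℕ) → Set
LS {k} h =
  Σ (Fin (sumℕ h) → Fin (sumℕ h) → Fin (sumℕ h)) λ L →
  IsLatin L ×
  Σ ((a : Fin k) → Subsquare L (h a)) λ S →
  ∀ a b → a ≢ b → Disjoint (S a) (S b)

-- ROS(p₁ … p_k): a non-negative rational function on multisets {i,j,ℓ}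
-- (a function on triples invariant under permutation), with
-- Σ_ℓ O(i,j,ℓ) = pᵢ pⱼ, O(i,i,i) = pᵢ², O(i,i,j) = 0 for i ≠ j.
record ROS {k : ℕ} (p : Fin k → ℕ) : Set where
  field
    O       : Fin k → Fin k → Fin k → ℚ
    symm₁₂  : ∀ i j l → O i j l ≡ O j i l
    symm₂₃  : ∀ i j l → O i j l ≡ O i l j
    nonneg  : ∀ i j l → 0ℚ ≤ℚ O i j l
    rowSum  : ∀ i j → sumℚ (λ l → O i j l) ≡ ℕ→ℚ (p i * p j)
    diag    : ∀ i → O i i i ≡ ℕ→ℚ (p i * p i)
    offDiag : ∀ i j → i ≢ j → O i i j ≡ 0ℚ

{-# OPTIONS --safe #-}
module Submission where

-- Let N(i,j,ℓ) count the cells of the latin square lying in a row of the i-th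
-- subsquare and a column of the j-th and holding a symbol of the ℓ-th. The
-- subsquares are disjoint and their orders sum to n, so their rows (columns,
-- symbols) partition those of the square; since every line of a latin square
-- holds each symbol exactly once, each two-dimensional margin of N is a product
-- hᵢhⱼ. Closure of a subsquare gives N(i,i,i) = hᵢ² and makes N vanish when two
-- of its arguments agree and the third differs. Averaging N over the six
-- permutations of its arguments yields the ROS.

open import Defs
open import Data.Nat using (ℕ; NonZero)
open import Data.Fin using (Fin)

open import Data.Nat.Base using (zero; suc; _+_; _*_; _≤_; z≤n; s≤s)
import Data.Nat.Properties as ℕ
open import Data.Nat.Tactic.RingSolver using (solve-∀)
import Data.Nat.Coprimality as Coprime
open import Data.Fin.Base using (zero; suc)
open import Data.Fin.Properties as Fin using (_≟_)
open import Data.Vec.Functional using (removeAt)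
import Data.Integer as ℤ
import Data.Integer.Properties as ℤ
open import Data.Rational as ℚ using (ℚ; mkℚ; 1ℚ; _/_)
import Data.Rational.Properties as ℚ
open import Data.Bool.Base using (if_then_else_)
open import Data.Product.Base using (∃; _,_; proj₁; proj₂; map₂)
open import Data.Sum.Base using (inj₁; inj₂)
open import Relation.Nullary using (does; yes; no; contradiction)
open import Relation.Binary.PropositionalEquality
open import Algebra.Properties.CommutativeMonoid.Sum ℕ.+-0-commutativeMonoid
  using (sum; sum-syntax; sum-cong-≗; sum-remove; ∑-comm; ∑-distrib-+)

open ≡-Reasoning

ℕ→ℚ-mkℚ : ∀ m → ℕ→ℚ m ≡ mkℚ (ℤ.+ m) 0 (Coprime.sym (Coprime.1-coprimeTo m))
ℕ→ℚ-mkℚ m = ℚ.normalize-coprime (Coprime.sym (Coprime.1-coprimeTo m))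

ℕ→ℚ-homo-+ : ∀ m n → ℕ→ℚ (m + n) ≡ ℕ→ℚ m ℚ.+ ℕ→ℚ n
ℕ→ℚ-homo-+ m n rewrite ℕ→ℚ-mkℚ m | ℕ→ℚ-mkℚ n =
  sym (ℚ./-cong (cong₂ ℤ._+_ (ℤ.*-identityʳ (ℤ.+ m)) (ℤ.*-identityʳ (ℤ.+ n))) refl)

ℕ→ℚ-homo-* : ∀ m n → ℕ→ℚ (m * n) ≡ ℕ→ℚ m ℚ.* ℕ→ℚ n
ℕ→ℚ-homo-* m n rewrite ℕ→ℚ-mkℚ m | ℕ→ℚ-mkℚ n = ℚ./-cong (ℤ.pos-* m n) refl

ℕ→ℚ-nonNeg : ∀ m → ℚ.NonNegative (ℕ→ℚ m)
ℕ→ℚ-nonNeg m = ℚ.normalize-nonNeg m 1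

⅙ : ℚ
⅙ = ℤ.+ 1 / 6

ℕ→ℚ-6*-⅙ : ∀ m → ℕ→ℚ (6 * m) ℚ.* ⅙ ≡ ℕ→ℚ m
ℕ→ℚ-6*-⅙ m = begin
  ℕ→ℚ (6 * m) ℚ.* ⅙       ≡⟨ cong (ℚ._* ⅙) (trans (cong ℕ→ℚ (ℕ.*-comm 6 m)) (ℕ→ℚ-homo-* m 6)) ⟩
  ℕ→ℚ m ℚ.* ℕ→ℚ 6 ℚ.* ⅙  ≡⟨ ℚ.*-assoc (ℕ→ℚ m) (ℕ→ℚ 6) ⅙ ⟩
  ℕ→ℚ m ℚ.* 1ℚ            ≡⟨ ℚ.*-identityʳ (ℕ→ℚ m) ⟩
  ℕ→ℚ m                   ∎

sumℚ-ℕ→ℚ-* : ∀ {k} (f : Fin k → ℕ) q → sumℚ (λ l → ℕ→ℚ (f l) ℚ.* q) ≡ ℕ→ℚ (sum f) ℚ.* q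
sumℚ-ℕ→ℚ-* {zero}  f q = sym (ℚ.*-zeroˡ q)
sumℚ-ℕ→ℚ-* {suc k} f q = begin
  ℕ→ℚ (f zero) ℚ.* q ℚ.+ sumℚ (λ l → ℕ→ℚ (f (suc l)) ℚ.* q)
    ≡⟨ cong (ℕ→ℚ (f zero) ℚ.* q ℚ.+_) (sumℚ-ℕ→ℚ-* (λ l → f (suc l)) q) ⟩
  ℕ→ℚ (f zero) ℚ.* q ℚ.+ ℕ→ℚ (sum (λ l → f (suc l))) ℚ.* q
    ≡⟨ ℚ.*-distribʳ-+ q (ℕ→ℚ (f zero)) _ ⟨
  (ℕ→ℚ (f zero) ℚ.+ ℕ→ℚ (sum (λ l → f (suc l)))) ℚ.* q
    ≡⟨ cong (ℚ._* q) (ℕ→ℚ-homo-+ (f zero) _) ⟨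
  ℕ→ℚ (sum f) ℚ.* q ∎

sumℕ≡sum : ∀ {n} (f : Fin n → ℕ) → sumℕ f ≡ sum f
sumℕ≡sum {zero}  f = refl
sumℕ≡sum {suc n} f = cong (f zero +_) (sumℕ≡sum (λ x → f (suc x)))

∑-const : ∀ {n} {f : Fin n → ℕ} {c} → (∀ x → f x ≡ c) → sum f ≡ n * c
∑-const {zero}  f≡c = refl
∑-const {suc n} f≡c = cong₂ _+_ (f≡c zero) (∑-const (λ x → f≡c (suc x)))

∑-zero : ∀ {n} {f : Fin n → ℕ} → (∀ x → f x ≡ 0) → sum f ≡ 0
∑-zero {n} f≡0 = trans (∑-const f≡0) (ℕ.*-zeroʳ n)

∑∑-ones : ∀ {m n} {F : Fin m → Fin n → ℕ} → (∀ a b → F a b ≡ 1) →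
          ∑[ a < m ] ∑[ b < n ] F a b ≡ m * n
∑∑-ones {n = n} F≡1 = ∑-const (λ a → trans (∑-const (F≡1 a)) (ℕ.*-identityʳ n))

∑∑-comm : ∀ {k m} {h : Fin k → ℕ} (F : (i : Fin k) → Fin (h i) → Fin m → ℕ) →
          ∑[ i < k ] ∑[ a < h i ] ∑[ b < m ] F i a b ≡ ∑[ b < m ] ∑[ i < k ] ∑[ a < h i ] F i a b
∑∑-comm {h = h} F = trans (sum-cong-≗ (λ i → ∑-comm (F i))) (∑-comm (λ i b → ∑[ a < h i ] F i a b))

∑-≤-card : ∀ {n} (f : Fin n → ℕ) → (∀ x → f x ≤ 1) → sum f ≤ n
∑-≤-card {zero}  f f≤1 = z≤n
∑-≤-card {suc n} f f≤1 = ℕ.+-mono-≤ (f≤1 zero) (∑-≤-card (λ x → f (suc x)) (λ x → f≤1 (suc x)))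

∑≡card⇒≡1 : ∀ {n} (f : Fin n → ℕ) → (∀ x → f x ≤ 1) → sum f ≡ n → ∀ x → f x ≡ 1
∑≡card⇒≡1 {suc n} f f≤1 ∑f≡n x with ℕ.n≤1⇒n≡0∨n≡1 (f≤1 x)
... | inj₂ fx≡1 = fx≡1
... | inj₁ fx≡0 = contradiction (subst (_≤ n) ∑rest≡1+n (∑-≤-card (removeAt f x) (λ _ → f≤1 _))) ℕ.1+n≰n
  where
  ∑rest≡1+n : sum (removeAt f x) ≡ suc n
  ∑rest≡1+n = begin
    sum (removeAt f x)        ≡⟨ cong (_+ sum (removeAt f x)) fx≡0 ⟨
    f x + sum (removeAt f x)  ≡⟨ sum-remove f ⟨
    sum f                     ≡⟨ ∑f≡n ⟩
    suc n                     ∎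

∑-positive : ∀ {n} (f : Fin n → ℕ) → 1 ≤ sum f → ∃ λ x → 1 ≤ f x
∑-positive {suc n} f 1≤∑f with f zero in f₀≡
... | suc _ = zero , subst (1 ≤_) (sym f₀≡) (s≤s z≤n)
... | zero  = let x , 1≤fx = ∑-positive (λ x → f (suc x)) 1≤∑f in suc x , 1≤fx

∑≤1 : ∀ {n} (f : Fin n → ℕ) → (∀ x → f x ≤ 1) →
      (∀ x y → 1 ≤ f x → 1 ≤ f y → x ≡ y) → sum f ≤ 1
∑≤1 {zero}  f f≤1 unique = z≤n
∑≤1 {suc n} f f≤1 unique with ℕ.n≤1⇒n≡0∨n≡1 (f≤1 zero)
... | inj₁ f₀≡0 = subst (λ f₀ → f₀ + sum (λ x → f (suc x)) ≤ 1) (sym f₀≡0)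
  (∑≤1 (λ x → f (suc x)) (λ x → f≤1 (suc x)) (λ x y p q → Fin.suc-injective (unique (suc x) (suc y) p q)))
... | inj₂ f₀≡1 = ℕ.≤-reflexive (cong₂ _+_ f₀≡1 (∑-zero rest≡0))
  where
  rest≡0 : ∀ x → f (suc x) ≡ 0
  rest≡0 x with ℕ.n≤1⇒n≡0∨n≡1 (f≤1 (suc x))
  ... | inj₁ fx≡0 = fx≡0
  ... | inj₂ fx≡1 with () ← unique zero (suc x) (ℕ.≤-reflexive (sym f₀≡1)) (ℕ.≤-reflexive (sym fx≡1))

δ : ∀ {n} → Fin n → Fin n → ℕ
δ x y = if does (x ≟ y) then 1 else 0

δ≤1 : ∀ {n} (x y : Fin n) → δ x y ≤ 1
δ≤1 x y with x ≟ y
... | yes _ = ℕ.≤-refl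
... | no  _ = z≤n

δ-pos⇒≡ : ∀ {n} {x y : Fin n} → 1 ≤ δ x y → x ≡ y
δ-pos⇒≡ {x = x} {y} with x ≟ y
... | yes x≡y = λ _ → x≡y
... | no  _   = λ ()

δ-≢ : ∀ {n} {x y : Fin n} → x ≢ y → δ x y ≡ 0
δ-≢ {x = x} {y} x≢y with x ≟ y
... | yes x≡y = contradiction x≡y x≢y
... | no  _   = refl

δ-cong-⇔ : ∀ {m n} {x y : Fin m} {x′ y′ : Fin n} →
           (x ≡ y → x′ ≡ y′) → (x′ ≡ y′ → x ≡ y) → δ x y ≡ δ x′ y′
δ-cong-⇔ {x = x} {y} {x′} {y′} to from with x ≟ y | x′ ≟ y′
... | yes _   | yes _   = refl
... | no  _   | no  _   = refl
... | yes x≡y | no  x≢y = contradiction (to x≡y) x≢y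
... | no  x≢y | yes x≡y = contradiction (from x≡y) x≢y

∑-δ : ∀ {n} (y : Fin n) → ∑[ x < n ] δ x y ≡ 1
∑-δ {suc n} zero    = cong suc (∑-zero {n} (λ _ → refl))
∑-δ {suc n} (suc y) = ∑-δ y

module Partition {k n} (h : Fin k → ℕ) (f : (a : Fin k) → Fin (h a) → Fin n)
  (f-injective : ∀ a → Injective (f a))
  (f-disjoint : ∀ a b → a ≢ b → ∀ t u → f a t ≢ f b u)
  (∑h≡n : sum h ≡ n) where

  multiplicity : Fin n → ℕ
  multiplicity x = ∑[ a < k ] ∑[ t < h a ] δ x (f a t)

  private
    block-multiplicity≤1 : ∀ x a → ∑[ t < h a ] δ x (f a t) ≤ 1
    block-multiplicity≤1 x a = ∑≤1 _ (λ t → δ≤1 x (f a t))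
      (λ t u p q → f-injective a t u (trans (sym (δ-pos⇒≡ {x = x} p)) (δ-pos⇒≡ {x = x} q)))

    hit : ∀ x a → 1 ≤ ∑[ t < h a ] δ x (f a t) → ∃ λ t → x ≡ f a t
    hit x a p = map₂ (δ-pos⇒≡ {x = x}) (∑-positive _ p)

    multiplicity≤1 : ∀ x → multiplicity x ≤ 1
    multiplicity≤1 x = ∑≤1 _ (block-multiplicity≤1 x) same-block
      where
      same-block : ∀ a b → 1 ≤ ∑[ t < h a ] δ x (f a t) → 1 ≤ ∑[ u < h b ] δ x (f b u) → a ≡ b
      same-block a b p q with a ≟ b | hit x a p | hit x b q
      ... | yes a≡b | _ | _ = a≡b
      ... | no a≢b | t , x≡fat | u , x≡fbu = contradiction (trans (sym x≡fat) x≡fbu) (f-disjoint a b a≢b t u)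

    ∑-multiplicity : sum multiplicity ≡ n
    ∑-multiplicity = begin
      ∑[ x < n ] ∑[ a < k ] ∑[ t < h a ] δ x (f a t)  ≡⟨ ∑∑-comm (λ a t x → δ x (f a t)) ⟨
      ∑[ a < k ] ∑[ t < h a ] ∑[ x < n ] δ x (f a t)  ≡⟨ sum-cong-≗ (λ a → ∑-const (λ t → ∑-δ (f a t))) ⟩
      ∑[ a < k ] (h a * 1)                            ≡⟨ sum-cong-≗ (λ a → ℕ.*-identityʳ (h a)) ⟩
      sum h                                           ≡⟨ ∑h≡n ⟩
      n                                               ∎

  multiplicity≡1 : ∀ x → multiplicity x ≡ 1
  multiplicity≡1 = ∑≡card⇒≡1 multiplicity multiplicity≤1 ∑-multiplicity

module _ {n} {L : Fin n → Fin n → Fin n} (L-latin : IsLatin L) where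
  open IsLatin L-latin

  δ-column : ∀ c s → ∃ λ r₀ → ∀ r → δ (L r c) s ≡ δ r₀ r
  δ-column c s = let r₀ , L[r₀,c]≡s = colSurj c s in r₀ , λ r → δ-cong-⇔
    (λ L[r,c]≡s → colInj c r₀ r (trans L[r₀,c]≡s (sym L[r,c]≡s)))
    (λ r₀≡r → subst (λ r → L r c ≡ s) r₀≡r L[r₀,c]≡s)

  δ-row : ∀ r s → ∃ λ c₀ → ∀ c → δ (L r c) s ≡ δ c₀ c
  δ-row r s = let c₀ , L[r,c₀]≡s = rowSurj r s in c₀ , λ c → δ-cong-⇔
    (λ L[r,c]≡s → rowInj r c₀ c (trans L[r,c₀]≡s (sym L[r,c]≡s)))
    (λ c₀≡c → subst (λ c → L r c ≡ s) c₀≡c L[r,c₀]≡s)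

  module _ {h} (S : Subsquare L h) where
    row-closed : ∀ {r} b c → L r (cols S b) ≡ syms S c → ∃ λ a → rows S a ≡ r
    row-closed {r} b c L[r,b]≡c = let a , sub[a,b]≡c = IsLatin.colSurj (subLatin S) b c in
      a , colInj (cols S b) (rows S a) r (trans (subEq S a b) (trans (cong (syms S) sub[a,b]≡c) (sym L[r,b]≡c)))

    col-closed : ∀ {c′} a c → L (rows S a) c′ ≡ syms S c → ∃ λ b → cols S b ≡ c′
    col-closed {c′} a c L[a,c′]≡c = let b , sub[a,b]≡c = IsLatin.rowSurj (subLatin S) a c in
      b , rowInj (rows S a) (cols S b) c′ (trans (subEq S a b) (trans (cong (syms S) sub[a,b]≡c) (sym L[a,c′]≡c)))

record UnsymmetrisedROS {k} (p : Fin k → ℕ) (N : Fin k → Fin k → Fin k → ℕ) : Set where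
  field
    ∑ᵢ : ∀ j l → ∑[ i < k ] N i j l ≡ p j * p l
    ∑ⱼ : ∀ i l → ∑[ j < k ] N i j l ≡ p i * p l
    ∑ₗ : ∀ i j → ∑[ l < k ] N i j l ≡ p i * p j
    diagonal : ∀ i → N i i i ≡ p i * p i
    iij≡0 : ∀ i j → i ≢ j → N i i j ≡ 0
    iji≡0 : ∀ i j → i ≢ j → N i j i ≡ 0
    jii≡0 : ∀ i j → i ≢ j → N j i i ≡ 0

module Symmetrise {k} {p : Fin k → ℕ} {N : Fin k → Fin k → Fin k → ℕ}
  (U : UnsymmetrisedROS p N) where
  open UnsymmetrisedROS U

  cyclic : Fin k → Fin k → Fin k → ℕ
  cyclic i j l = N i j l + N j l i + N l i j

  symmetrised : Fin k → Fin k → Fin k → ℕ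
  symmetrised i j l = cyclic i j l + cyclic j i l

  cyclic-rotate : ∀ i j l → cyclic i j l ≡ cyclic j l i
  cyclic-rotate i j l = rotate (N i j l) (N j l i) (N l i j)
    where
    rotate : ∀ x y z → x + y + z ≡ y + z + x
    rotate = solve-∀

  symmetrised-swap₁₂ : ∀ i j l → symmetrised i j l ≡ symmetrised j i l
  symmetrised-swap₁₂ i j l = ℕ.+-comm (cyclic i j l) (cyclic j i l)

  symmetrised-swap₂₃ : ∀ i j l → symmetrised i j l ≡ symmetrised i l j
  symmetrised-swap₂₃ i j l = begin
    cyclic i j l + cyclic j i l  ≡⟨ ℕ.+-comm (cyclic i j l) (cyclic j i l) ⟩
    cyclic j i l + cyclic i j l  ≡⟨ cong₂ _+_ (cyclic-rotate j i l) (trans (cyclic-rotate i j l) (cyclic-rotate j l i)) ⟩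
    cyclic i l j + cyclic l i j  ∎

  ∑-cyclic : ∀ i j → ∑[ l < k ] cyclic i j l ≡ p i * p j + p j * p i + p i * p j
  ∑-cyclic i j = begin
    ∑[ l < k ] (N i j l + N j l i + N l i j)
      ≡⟨ ∑-distrib-+ (λ l → N i j l + N j l i) (λ l → N l i j) ⟩
    ∑[ l < k ] (N i j l + N j l i) + ∑[ l < k ] N l i j
      ≡⟨ cong (_+ ∑[ l < k ] N l i j) (∑-distrib-+ (λ l → N i j l) (λ l → N j l i)) ⟩
    ∑[ l < k ] N i j l + ∑[ l < k ] N j l i + ∑[ l < k ] N l i j
      ≡⟨ cong₂ _+_ (cong₂ _+_ (∑ₗ i j) (∑ⱼ j i)) (∑ᵢ i j) ⟩
    p i * p j + p j * p i + p i * p j ∎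

  ∑-symmetrised : ∀ i j → ∑[ l < k ] symmetrised i j l ≡ 6 * (p i * p j)
  ∑-symmetrised i j = begin
    ∑[ l < k ] (cyclic i j l + cyclic j i l)
      ≡⟨ ∑-distrib-+ (cyclic i j) (cyclic j i) ⟩
    ∑[ l < k ] cyclic i j l + ∑[ l < k ] cyclic j i l
      ≡⟨ cong₂ _+_ (∑-cyclic i j) (∑-cyclic j i) ⟩
    (p i * p j + p j * p i + p i * p j) + (p j * p i + p i * p j + p j * p i)
      ≡⟨ six-products (p i) (p j) ⟩
    6 * (p i * p j) ∎
    where
    six-products : ∀ x y → (x * y + y * x + x * y) + (y * x + x * y + y * x) ≡ 6 * (x * y)
    six-products = solve-∀

  symmetrised-diagonal : ∀ i → symmetrised i i i ≡ 6 * (p i * p i)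
  symmetrised-diagonal i rewrite diagonal i = six-copies (p i * p i)
    where
    six-copies : ∀ x → (x + x + x) + (x + x + x) ≡ 6 * x
    six-copies = solve-∀

  symmetrised-iij≡0 : ∀ i j → i ≢ j → symmetrised i i j ≡ 0
  symmetrised-iij≡0 i j i≢j rewrite iij≡0 i j i≢j | iji≡0 i j i≢j | jii≡0 i j i≢j = refl

  ros : ROS p
  ros = record
    { O       = O
    ; symm₁₂  = λ i j l → cong (λ m → ℕ→ℚ m ℚ.* ⅙) (symmetrised-swap₁₂ i j l)
    ; symm₂₃  = λ i j l → cong (λ m → ℕ→ℚ m ℚ.* ⅙) (symmetrised-swap₂₃ i j l)
    ; nonneg  = λ i j l → ℚ.nonNegative⁻¹ (O i j l)
                  {{ℚ.nonNeg*nonNeg⇒nonNeg (ℕ→ℚ (symmetrised i j l)) {{ℕ→ℚ-nonNeg (symmetrised i j l)}} ⅙}}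
    ; rowSum  = λ i j → begin
        sumℚ (O i j)                               ≡⟨ sumℚ-ℕ→ℚ-* (symmetrised i j) ⅙ ⟩
        ℕ→ℚ (∑[ l < k ] symmetrised i j l) ℚ.* ⅙  ≡⟨ cong (λ m → ℕ→ℚ m ℚ.* ⅙) (∑-symmetrised i j) ⟩
        ℕ→ℚ (6 * (p i * p j)) ℚ.* ⅙               ≡⟨ ℕ→ℚ-6*-⅙ (p i * p j) ⟩
        ℕ→ℚ (p i * p j)                            ∎
    ; diag    = λ i → trans (cong (λ m → ℕ→ℚ m ℚ.* ⅙) (symmetrised-diagonal i)) (ℕ→ℚ-6*-⅙ (p i * p i))
    ; offDiag = λ i j i≢j → cong (λ m → ℕ→ℚ m ℚ.* ⅙) (symmetrised-iij≡0 i j i≢j)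
    }
    where
    O : Fin k → Fin k → Fin k → ℚ
    O i j l = ℕ→ℚ (symmetrised i j l) ℚ.* ⅙

module LatinCounts {k n} {h : Fin k → ℕ} {L : Fin n → Fin n → Fin n} (L-latin : IsLatin L)
  (S : (i : Fin k) → Subsquare L (h i))
  (disjoint : ∀ i j → i ≢ j → Disjoint (S i) (S j))
  (∑h≡n : sum h ≡ n) where

  rows-cover : ∀ r → ∑[ i < k ] ∑[ a < h i ] δ r (rows (S i) a) ≡ 1
  rows-cover = Partition.multiplicity≡1 h (λ i → rows (S i)) (λ i → rowsInj (S i))
    (λ i j i≢j → proj₁ (disjoint i j i≢j)) ∑h≡n

  cols-cover : ∀ c → ∑[ i < k ] ∑[ b < h i ] δ c (cols (S i) b) ≡ 1
  cols-cover = Partition.multiplicity≡1 h (λ i → cols (S i)) (λ i → colsInj (S i))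
    (λ i j i≢j → proj₁ (proj₂ (disjoint i j i≢j))) ∑h≡n

  syms-cover : ∀ s → ∑[ i < k ] ∑[ c < h i ] δ s (syms (S i) c) ≡ 1
  syms-cover = Partition.multiplicity≡1 h (λ i → syms (S i)) (λ i → symsInj (S i))
    (λ i j i≢j → proj₂ (proj₂ (disjoint i j i≢j))) ∑h≡n

  cell : ∀ i j l → Fin (h i) → Fin (h j) → Fin (h l) → ℕ
  cell i j l a b c = δ (L (rows (S i) a) (cols (S j) b)) (syms (S l) c)

  N : Fin k → Fin k → Fin k → ℕ
  N i j l = ∑[ a < h i ] ∑[ b < h j ] ∑[ c < h l ] cell i j l a b c

  ∑ᵢN : ∀ j l → ∑[ i < k ] N i j l ≡ h j * h l
  ∑ᵢN j l = begin
    ∑[ i < k ] ∑[ a < h i ] ∑[ b < h j ] ∑[ c < h l ] cell i j l a b c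
      ≡⟨ ∑∑-comm (λ i a b → ∑[ c < h l ] cell i j l a b c) ⟩
    ∑[ b < h j ] ∑[ i < k ] ∑[ a < h i ] ∑[ c < h l ] cell i j l a b c
      ≡⟨ sum-cong-≗ (λ b → ∑∑-comm (λ i a c → cell i j l a b c)) ⟩
    ∑[ b < h j ] ∑[ c < h l ] ∑[ i < k ] ∑[ a < h i ] cell i j l a b c
      ≡⟨ ∑∑-ones column-count ⟩
    h j * h l ∎
    where
    column-count : ∀ b c → ∑[ i < k ] ∑[ a < h i ] cell i j l a b c ≡ 1
    column-count b c = let r₀ , δ≡ = δ-column L-latin (cols (S j) b) (syms (S l) c) in
      trans (sum-cong-≗ (λ i → sum-cong-≗ (λ a → δ≡ (rows (S i) a)))) (rows-cover r₀)

  ∑ⱼN : ∀ i l → ∑[ j < k ] N i j l ≡ h i * h l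
  ∑ⱼN i l = begin
    ∑[ j < k ] ∑[ a < h i ] ∑[ b < h j ] ∑[ c < h l ] cell i j l a b c
      ≡⟨ ∑-comm (λ j a → ∑[ b < h j ] ∑[ c < h l ] cell i j l a b c) ⟩
    ∑[ a < h i ] ∑[ j < k ] ∑[ b < h j ] ∑[ c < h l ] cell i j l a b c
      ≡⟨ sum-cong-≗ (λ a → ∑∑-comm (λ j b c → cell i j l a b c)) ⟩
    ∑[ a < h i ] ∑[ c < h l ] ∑[ j < k ] ∑[ b < h j ] cell i j l a b c
      ≡⟨ ∑∑-ones row-count ⟩
    h i * h l ∎
    where
    row-count : ∀ a c → ∑[ j < k ] ∑[ b < h j ] cell i j l a b c ≡ 1
    row-count a c = let c₀ , δ≡ = δ-row L-latin (rows (S i) a) (syms (S l) c) in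
      trans (sum-cong-≗ (λ j → sum-cong-≗ (λ b → δ≡ (cols (S j) b)))) (cols-cover c₀)

  ∑ₗN : ∀ i j → ∑[ l < k ] N i j l ≡ h i * h j
  ∑ₗN i j = begin
    ∑[ l < k ] ∑[ a < h i ] ∑[ b < h j ] ∑[ c < h l ] cell i j l a b c
      ≡⟨ ∑-comm (λ l a → ∑[ b < h j ] ∑[ c < h l ] cell i j l a b c) ⟩
    ∑[ a < h i ] ∑[ l < k ] ∑[ b < h j ] ∑[ c < h l ] cell i j l a b c
      ≡⟨ sum-cong-≗ (λ a → ∑-comm (λ l b → ∑[ c < h l ] cell i j l a b c)) ⟩
    ∑[ a < h i ] ∑[ b < h j ] ∑[ l < k ] ∑[ c < h l ] cell i j l a b c
      ≡⟨ ∑∑-ones (λ a b → syms-cover (L (rows (S i) a) (cols (S j) b))) ⟩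
    h i * h j ∎

  N-diagonal : ∀ i → N i i i ≡ h i * h i
  N-diagonal i = ∑∑-ones (λ a b → trans (sum-cong-≗ (δ-sub a b)) (∑-δ (sub (S i) a b)))
    where
    δ-sub : ∀ a b c → cell i i i a b c ≡ δ c (sub (S i) a b)
    δ-sub a b c = δ-cong-⇔
      (λ L≡s → symsInj (S i) c (sub (S i) a b) (trans (sym L≡s) (subEq (S i) a b)))
      (λ c≡sub → trans (subEq (S i) a b) (cong (syms (S i)) (sym c≡sub)))

  N≡0 : ∀ {i j l} → (∀ a b c → L (rows (S i) a) (cols (S j) b) ≢ syms (S l) c) → N i j l ≡ 0
  N≡0 no-cell = ∑-zero (λ a → ∑-zero (λ b → ∑-zero (λ c → δ-≢ (no-cell a b c))))

  unsymmetrisedROS : UnsymmetrisedROS h N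
  unsymmetrisedROS = record
    { ∑ᵢ = ∑ᵢN
    ; ∑ⱼ = ∑ⱼN
    ; ∑ₗ = ∑ₗN
    ; diagonal = N-diagonal
    ; iij≡0 = λ i j i≢j → N≡0 λ a b c L≡s →
        proj₂ (proj₂ (disjoint i j i≢j)) (sub (S i) a b) c (trans (sym (subEq (S i) a b)) L≡s)
    ; iji≡0 = λ i j i≢j → N≡0 λ a b c L≡s →
        let b′ , cols≡ = col-closed L-latin (S i) a c L≡s in proj₁ (proj₂ (disjoint i j i≢j)) b′ b cols≡
    ; jii≡0 = λ i j i≢j → N≡0 λ a b c L≡s →
        let a′ , rows≡ = row-closed L-latin (S i) b c L≡s in proj₁ (disjoint i j i≢j) a′ a rows≡
    }

mainTheorem8 : ∀ (k : ℕ) (h : Fin k → ℕ) → (∀ i → NonZero (h i)) → LS h → ROS h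
mainTheorem8 k h _ (L , L-latin , S , disjoint) =
  Symmetrise.ros (LatinCounts.unsymmetrisedROS L-latin S disjoint (sym (sumℕ≡sum h)))
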